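{- Let $l$ be a positive integer and let $(U(n))_{n\geqslant0}$ be an arithmetic progression of positive integers, $U(n)=U(0)+n d$ with common difference $d$. Let $n\geqslant0$ be such that $U(n),U(n+1),U(n+2),U(n+3)$ all have exactly $l$ decimal digits. (i) If $(S(n))_{n\geqslant0}$ is the right-concatenation of $(U(n))$, then $$S(n+3)-(10^l+2)\,S(n+2)+(2\cdot 10^l+1)\,S(n+1)-10^l\,S(n)=0 .$$ (ii) If $(S(n))_{n\geqslant0}$ is the left-concatenation of $(U(n))$, then $$S(n+3)-(2\cdot 10^l+1)\,S(n+2)+(10^{2l}+2\cdot10^l)\,S(n+1)-10^{2l}\,S(n)=0 .$$
   Context: For a positive integer $m$, write $\mathrm{len}(m)$ for the number of decimal digits of $m$. The right-concatenation of a sequence of positive integers $(U(n))_{n\geqslant0}$ is the sequence $S(n)$ whose decimal representation is the concatenation of those of $U(0),U(1),\ldots,U(n)$ in this order; i.e. $S(0)=U(0)$ and $S(n+1)=10^{\mathrm{len}(U(n+1))}S(n)+U(n+1)$. The left-concatenation is the sequence $S(n)$ whose decimal representation is the concatenation of those of $U(n),U(n-1),\ldots,U(0)$ in this order; i.e. $S(0)=U(0)$ and $S(n+1)=U(n+1)\cdot 10^{\mathrm{len}(S(n))}+S(n)$. -}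

module Defs where

open import Data.Nat using (ℕ; zero; suc; _+_; _*_; _^_; _/_; _<_)

-- number of decimal digits of m (for m ≥ 1); uses fuel m, which suffices
-- since m / 10 < m for m ≥ 1.  len 0 = 0 (irrelevant: only applied to positive integers).
lenAux : ℕ → ℕ → ℕ
lenAux zero    m       = 0
lenAux (suc f) zero    = 0
lenAux (suc f) (suc m) = suc (lenAux f (suc m / 10))

len : ℕ → ℕ
len m = lenAux m m

rightConcat : (ℕ → ℕ) → ℕ → ℕ
rightConcat U zero    = U zero
rightConcat U (suc n) = 10 ^ len (U (suc n)) * rightConcat U n + U (suc n)

leftConcat : (ℕ → ℕ) → ℕ → ℕ
leftConcat U zero    = U zero
leftConcat U (suc n) = U (suc n) * 10 ^ len (leftConcat U n) + leftConcat U n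

-- If U(n+1), U(n+2), U(n+3) all have l digits, each concatenation step multiplies by a fixed
-- power of ten: S(k+1) = 10^l S(k) + U(k+1) on the right, and S(k+1) = U(k+1) 10^(L_k) + S(k)
-- on the left, where L_{k+1} = L_k + l.  Since U(n+1), U(n+2), U(n+3) form an arithmetic
-- progression, the three steps from S(n) are then described by 10^l, U(n+1) and d alone
-- (plus 10^(L_n) on the left), and both recurrences become polynomial identities over ℤ.
module Submission where

open import Defs
open import Data.Nat using (ℕ; zero; suc; _<_; _≤_; s≤s; z≤n; _/_; _%_)
import Data.Nat as ℕ
import Data.Nat.Properties as ℕₚ
open import Data.Nat.DivMod using (m/n<m; m≡m%n+[m/n]*n; m%n<n; m*n/n≡m; m<n*o⇒m/o<n; +-distrib-/-∣ˡ)
open import Data.Nat.Divisibility using (divides)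
open import Data.Integer using (ℤ; +_; _+_; _-_; _*_; _^_)
import Data.Integer.Properties as ℤₚ
open import Data.Integer.Tactic.RingSolver using (solve-∀)
open import Data.Product using (_×_; _,_)
open import Relation.Binary.PropositionalEquality using (_≡_; refl; sym; trans; cong; subst; module ≡-Reasoning)

suc/10≤ : ∀ m → suc m / 10 ≤ m
suc/10≤ m = ℕₚ.≤-pred (m/n<m (suc m) 10 (s≤s (s≤s z≤n)))

lenAux-fuel-irrelevant : ∀ f g m → m ≤ f → m ≤ g → lenAux f m ≡ lenAux g m
lenAux-fuel-irrelevant zero    zero    m       _       _       = refl
lenAux-fuel-irrelevant zero    (suc g) zero    _       _       = refl
lenAux-fuel-irrelevant (suc f) zero    zero    _       _       = refl
lenAux-fuel-irrelevant (suc f) (suc g) zero    _       _       = refl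
lenAux-fuel-irrelevant (suc f) (suc g) (suc m) (s≤s m≤f) (s≤s m≤g) =
  cong suc (lenAux-fuel-irrelevant f g (suc m / 10)
             (ℕₚ.≤-trans (suc/10≤ m) m≤f) (ℕₚ.≤-trans (suc/10≤ m) m≤g))

len-suc : ∀ m → len (suc m) ≡ suc (len (suc m / 10))
len-suc m = cong suc (lenAux-fuel-irrelevant m (suc m / 10) (suc m / 10) (suc/10≤ m) ℕₚ.≤-refl)

len-pos : ∀ {m} → 0 < m → len m ≡ suc (len (m / 10))
len-pos {suc m} _ = len-suc m

n<10^len : ∀ n → n < 10 ℕ.^ len n
n<10^len n = len≡⇒<10^ (len n) n refl
  where
  len≡⇒<10^ : ∀ k m → len m ≡ k → m < 10 ℕ.^ k
  len≡⇒<10^ k       zero    _ = ℕₚ.m^n>0 10 k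
  len≡⇒<10^ zero    (suc m) e with trans (sym (len-suc m)) e
  ... | ()
  len≡⇒<10^ (suc k) (suc m) e = begin-strict
    suc m                            ≡⟨ m≡m%n+[m/n]*n (suc m) 10 ⟩
    suc m % 10 ℕ.+ suc m / 10 ℕ.* 10 <⟨ ℕₚ.+-monoˡ-< _ (m%n<n (suc m) 10) ⟩
    suc (suc m / 10) ℕ.* 10          ≤⟨ ℕₚ.*-monoˡ-≤ 10 ih ⟩
    10 ℕ.^ k ℕ.* 10                  ≡⟨ ℕₚ.*-comm (10 ℕ.^ k) 10 ⟩
    10 ℕ.^ suc k                     ∎
    where
    open ℕₚ.≤-Reasoning
    ih : suc m / 10 < 10 ℕ.^ k
    ih = len≡⇒<10^ k (suc m / 10) (ℕₚ.suc-injective (trans (sym (len-suc m)) e))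

len-*10^-+ : ∀ k a b → 0 < a → b < 10 ℕ.^ k → len (a ℕ.* 10 ℕ.^ k ℕ.+ b) ≡ len a ℕ.+ k
len-*10^-+ zero    a zero    _ _ rewrite ℕₚ.*-identityʳ a | ℕₚ.+-identityʳ a | ℕₚ.+-identityʳ (len a) = refl
len-*10^-+ zero    a (suc b) _ (s≤s ())
len-*10^-+ (suc k) a b 0<a b<10^1+k = begin
  len (a ℕ.* 10 ℕ.^ suc k ℕ.+ b)     ≡⟨ cong (λ x → len (x ℕ.+ b)) regroup ⟩
  len (a′ ℕ.* 10 ℕ.+ b)              ≡⟨ len-pos (ℕₚ.<-≤-trans 0<a′*10 (ℕₚ.m≤m+n _ b)) ⟩
  suc (len ((a′ ℕ.* 10 ℕ.+ b) / 10)) ≡⟨ cong (λ x → suc (len x)) shift-div ⟩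
  suc (len (a′ ℕ.+ b / 10))          ≡⟨ cong suc (len-*10^-+ k a (b / 10) 0<a b/10<10^k) ⟩
  suc (len a ℕ.+ k)                  ≡⟨ ℕₚ.+-suc (len a) k ⟨
  len a ℕ.+ suc k                    ∎
  where
  open ≡-Reasoning
  a′ : ℕ
  a′ = a ℕ.* 10 ℕ.^ k
  regroup : a ℕ.* 10 ℕ.^ suc k ≡ a′ ℕ.* 10
  regroup = trans (cong (a ℕ.*_) (ℕₚ.*-comm 10 (10 ℕ.^ k))) (sym (ℕₚ.*-assoc a (10 ℕ.^ k) 10))
  0<a′*10 : 0 < a′ ℕ.* 10
  0<a′*10 = subst (0 <_) regroup (ℕₚ.*-mono-< 0<a (ℕₚ.m^n>0 10 (suc k)))
  shift-div : (a′ ℕ.* 10 ℕ.+ b) / 10 ≡ a′ ℕ.+ b / 10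
  shift-div = trans (+-distrib-/-∣ˡ b (divides a′ refl)) (cong (ℕ._+ b / 10) (m*n/n≡m a′ 10))
  b/10<10^k : b / 10 < 10 ℕ.^ k
  b/10<10^k = m<n*o⇒m/o<n (subst (b <_) (ℕₚ.*-comm 10 (10 ℕ.^ k)) b<10^1+k)

len-leftConcat-suc : ∀ U → (∀ k → 0 < U k) → ∀ k →
                     len (leftConcat U (suc k)) ≡ len (U (suc k)) ℕ.+ len (leftConcat U k)
len-leftConcat-suc U U>0 k =
  len-*10^-+ (len (leftConcat U k)) (U (suc k)) (leftConcat U k) (U>0 (suc k)) (n<10^len _)

pos-^ : ∀ a k → + (a ℕ.^ k) ≡ (+ a) ^ k
pos-^ a zero    = refl
pos-^ a (suc k) = trans (ℤₚ.pos-* a (a ℕ.^ k)) (cong (+ a *_) (pos-^ a k))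

pos-*-+ : ∀ a b c → + (a ℕ.* b ℕ.+ c) ≡ + a * + b + + c
pos-*-+ a b c = trans (ℤₚ.pos-+ (a ℕ.* b) c) (cong (_+ + c) (ℤₚ.pos-* a b))

rightConcat-suc : ∀ U k {l u} → len (U (suc k)) ≡ l → + U (suc k) ≡ u →
                  + rightConcat U (suc k) ≡ (+ 10) ^ l * + rightConcat U k + u
rightConcat-suc U k refl refl =
  trans (pos-*-+ (10 ℕ.^ len (U (suc k))) (rightConcat U k) (U (suc k)))
        (cong (λ x → x * + rightConcat U k + + U (suc k)) (pos-^ 10 (len (U (suc k)))))

leftConcat-suc : ∀ U k {u} → + U (suc k) ≡ u →
                 + leftConcat U (suc k) ≡ u * (+ 10) ^ len (leftConcat U k) + + leftConcat U k
leftConcat-suc U k refl =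
  trans (pos-*-+ (U (suc k)) (10 ℕ.^ len (leftConcat U k)) (leftConcat U k))
        (cong (λ x → + U (suc k) * x + + leftConcat U k) (pos-^ 10 (len (leftConcat U k))))

10^len-leftConcat-suc : ∀ U → (∀ k → 0 < U k) → ∀ k {l} → len (U (suc k)) ≡ l →
                        (+ 10) ^ len (leftConcat U (suc k)) ≡ (+ 10) ^ len (leftConcat U k) * (+ 10) ^ l
10^len-leftConcat-suc U U>0 k {l} refl = begin
  (+ 10) ^ len (leftConcat U (suc k))          ≡⟨ cong ((+ 10) ^_) (len-leftConcat-suc U U>0 k) ⟩
  (+ 10) ^ (l ℕ.+ len (leftConcat U k))        ≡⟨ cong ((+ 10) ^_) (ℕₚ.+-comm l _) ⟩
  (+ 10) ^ (len (leftConcat U k) ℕ.+ l)        ≡⟨ ℤₚ.^-distribˡ-+-* (+ 10) (len (leftConcat U k)) l ⟩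
  (+ 10) ^ len (leftConcat U k) * (+ 10) ^ l   ∎
  where open ≡-Reasoning

arithmetic-suc : ∀ (U : ℕ → ℕ) d → (∀ k → + U k ≡ + U 0 + + k * d) → ∀ k → + U (suc k) ≡ + U k + d
arithmetic-suc U d U≡ k rewrite U≡ (suc k) | U≡ k | ℤₚ.pos-+ 1 k = shift (+ U 0) (+ k) d
  where
  shift : ∀ a b d → a + (+ 1 + b) * d ≡ a + b * d + d
  shift = solve-∀

right-recurrence : ∀ X u d S₀ S₁ S₂ S₃ →
                   S₁ ≡ X * S₀ + u → S₂ ≡ X * S₁ + (u + d) → S₃ ≡ X * S₂ + (u + d + d) →
                   S₃ - (X + + 2) * S₂ + (+ 2 * X + + 1) * S₁ - X * S₀ ≡ + 0
right-recurrence X u d S₀ _ _ _ refl refl refl = identity X u d S₀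
  where
  identity : ∀ X u d S₀ →
             X * (X * (X * S₀ + u) + (u + d)) + (u + d + d)
             - (X + + 2) * (X * (X * S₀ + u) + (u + d))
             + (+ 2 * X + + 1) * (X * S₀ + u) - X * S₀ ≡ + 0
  identity = solve-∀

left-recurrence : ∀ X X² u d Y₀ Y₁ Y₂ S₀ S₁ S₂ S₃ → X² ≡ X * X → Y₁ ≡ Y₀ * X → Y₂ ≡ Y₁ * X →
                  S₁ ≡ u * Y₀ + S₀ → S₂ ≡ (u + d) * Y₁ + S₁ → S₃ ≡ (u + d + d) * Y₂ + S₂ →
                  S₃ - (+ 2 * X + + 1) * S₂ + (X² + + 2 * X) * S₁ - X² * S₀ ≡ + 0
left-recurrence X _ u d Y₀ _ _ S₀ _ _ _ refl refl refl refl refl refl = identity X u d Y₀ S₀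
  where
  identity : ∀ X u d Y₀ S₀ →
             (u + d + d) * (Y₀ * X * X) + ((u + d) * (Y₀ * X) + (u * Y₀ + S₀))
             - (+ 2 * X + + 1) * ((u + d) * (Y₀ * X) + (u * Y₀ + S₀))
             + (X * X + + 2 * X) * (u * Y₀ + S₀) - X * X * S₀ ≡ + 0
  identity = solve-∀

lemma2 : (l : ℕ) → 0 < l → (U : ℕ → ℕ) → (∀ k → 0 < U k) →
         (d : ℤ) → (∀ k → + U k ≡ + U 0 + + k * d) →
         (n : ℕ) →
         len (U n) ≡ l → len (U (suc n)) ≡ l →
         len (U (suc (suc n))) ≡ l → len (U (suc (suc (suc n)))) ≡ l →
         ((+ rightConcat U (suc (suc (suc n)))
            - ((+ 10) ^ l + + 2) * + rightConcat U (suc (suc n))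
            + (+ 2 * (+ 10) ^ l + + 1) * + rightConcat U (suc n)
            - (+ 10) ^ l * + rightConcat U n) ≡ + 0)
         ×
         ((+ leftConcat U (suc (suc (suc n)))
            - (+ 2 * (+ 10) ^ l + + 1) * + leftConcat U (suc (suc n))
            + ((+ 10) ^ (l ℕ.+ l) + + 2 * (+ 10) ^ l) * + leftConcat U (suc n)
            - (+ 10) ^ (l ℕ.+ l) * + leftConcat U n) ≡ + 0)
lemma2 l _ U U>0 d U≡ n _ len₁ len₂ len₃ =
  right-recurrence ((+ 10) ^ l) (+ U (suc n)) d (+ rightConcat U n) _ _ _
    (rightConcat-suc U n len₁ refl)
    (rightConcat-suc U (suc n) len₂ u₂)
    (rightConcat-suc U (suc (suc n)) len₃ u₃)
  ,
  left-recurrence ((+ 10) ^ l) _ (+ U (suc n)) d _ _ _ (+ leftConcat U n) _ _ _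
    (ℤₚ.^-distribˡ-+-* (+ 10) l l)
    (10^len-leftConcat-suc U U>0 n len₁)
    (10^len-leftConcat-suc U U>0 (suc n) len₂)
    (leftConcat-suc U n refl)
    (leftConcat-suc U (suc n) u₂)
    (leftConcat-suc U (suc (suc n)) u₃)
  where
  u₂ : + U (suc (suc n)) ≡ + U (suc n) + d
  u₂ = arithmetic-suc U d U≡ (suc n)
  u₃ : + U (suc (suc (suc n))) ≡ + U (suc n) + d + d
  u₃ = trans (arithmetic-suc U d U≡ (suc (suc n))) (cong (_+ d) u₂)
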